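{- Let $M$ be a tropical oriented matroid with parameters $(n,d)$, and let $A=(A_1,\dots,A_n)\in M$ be such that the subgraph of $K_{n,d}$ with edges $(i,j)$, $j\in A_i$, contains no cycle. Let $i\in[n]$ with $|A_i|>1$, let $k\in A_i$, and let $A'$ be obtained from $A$ by replacing $A_i$ with $A_i\setminus\{k\}$. Then $A'\in M$ (indeed $A'$ is a refinement of $A$).
   Context: An $(n,d)$-type is an $n$-tuple $A=(A_1,\dots,A_n)$ of nonempty subsets of $[d]$. Refinement: for an ordered partition $P=(P_1,\dots,P_r)$ of $[d]$, $A_P=(A_1\cap P_{m(1)},\dots,A_n\cap P_{m(n)})$ where $m(i)$ is the largest index with $A_i\cap P_{m(i)}\ne\emptyset$. Comparability graph: for types $A,B$, $CG_{A,B}$ has vertex set $[d]$, and for each $i$ and each $j\in A_i$, $k\in B_i$ an edge between $j$ and $k$, undirected if $j,k\in A_i\cap B_i$ and directed $j\to k$ otherwise; it is acyclic if there is no closed walk using edges either in their direction or undirected, containing at least one directed edge. A tropical oriented matroid with parameters $(n,d)$ is a collection $M$ of $(n,d)$-types satisfying: (Boundary) for each $j\in[d]$, $(\{j\},\dots,\{j\})\in M$; (Elimination) for $A,B\in M$ and $j\in[n]$ there is $C\in M$ with $C_j=A_j\cup B_j$ and $C_k\in\{A_k,B_k,A_k\cup B_k\}$ for all $k$; (Comparability) $CG_{A,B}$ is acyclic for all $A,B\in M$; (Surrounding) every refinement of a type in $M$ is in $M$. -}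

module Defs where

open import Data.Nat using (ℕ; zero; suc; _<_; _≤_)
open import Data.Nat.DivMod using (_%_; m%n<n)
open import Data.Fin using (Fin; toℕ; fromℕ<; _≟_) renaming (_≤_ to _≤ᶠ_)
open import Data.Fin.Subset using (Subset; _∈_; _∉_; _∩_; _∪_; _-_; ⁅_⁆; Nonempty)
open import Data.Product using (Σ; ∃; ∃-syntax; _×_; _,_)
open import Data.Sum using (_⊎_)
open import Relation.Nullary using (¬_; yes; no)
open import Relation.Binary.PropositionalEquality using (_≡_)
open import Relation.Binary.Construct.Closure.ReflexiveTransitive using (Star)
open import Function.Definitions using (Injective; Surjective)

Tuple : ℕ → ℕ → Set
Tuple n d = Fin n → Subset d

IsType : ∀ {n d} → Tuple n d → Set
IsType A = ∀ i → Nonempty (A i)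

-- An ordered partition (P_1,…,P_r) of [d] (blocks nonempty, disjoint, covering)
-- is encoded by the surjective block-assignment map f : [d] → [r],
-- with P_m = f⁻¹(m).
IsOrderedPartition : ∀ {d r} → (Fin d → Fin r) → Set
IsOrderedPartition f = Surjective _≡_ _≡_ f

-- C is the refinement A_P of A by the ordered partition encoded by f:
-- for each i, m(i) is the largest block index meeting A_i, and
-- C_i = A_i ∩ P_{m(i)}.
IsRefinementBy : ∀ {n d r} → Tuple n d → (Fin d → Fin r) → Tuple n d → Set
IsRefinementBy {n} {d} {r} A f C =
  ∀ (i : Fin n) → Σ (Fin r) λ m →
      (∃[ j ] (j ∈ A i × f j ≡ m))
    × (∀ j → j ∈ A i → f j ≤ᶠ m)
    × (∀ j → (j ∈ C i → (j ∈ A i × f j ≡ m)) × ((j ∈ A i × f j ≡ m) → j ∈ C i))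

IsRefinement : ∀ {n d} → Tuple n d → Tuple n d → Set
IsRefinement {n} {d} A C =
  ∃[ r ] Σ (Fin d → Fin r) λ f → IsOrderedPartition f × IsRefinementBy A f C

UndEdge : ∀ {n d} → Tuple n d → Tuple n d → Fin d → Fin d → Set
UndEdge A B j k = ∃[ i ] (j ∈ (A i ∩ B i) × k ∈ (A i ∩ B i))

DirEdge : ∀ {n d} → Tuple n d → Tuple n d → Fin d → Fin d → Set
DirEdge A B j k =
  ∃[ i ] (j ∈ A i × k ∈ B i × ¬ (j ∈ (A i ∩ B i) × k ∈ (A i ∩ B i)))

Step : ∀ {n d} → Tuple n d → Tuple n d → Fin d → Fin d → Set
Step A B j k = UndEdge A B j k ⊎ DirEdge A B j k

-- A closed walk containing at least one directed edge, rotated so that it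
-- starts with a directed edge j → k and then returns from k to j.
HasBadCycle : ∀ {n d} → Tuple n d → Tuple n d → Set
HasBadCycle A B = ∃[ j ] ∃[ k ] (DirEdge A B j k × Star (Step A B) k j)

CGAcyclic : ∀ {n d} → Tuple n d → Tuple n d → Set
CGAcyclic A B = ¬ HasBadCycle A B

record IsTOM (n d : ℕ) (M : Tuple n d → Set) : Set₁ where
  field
    types       : ∀ A → M A → IsType A
    boundary    : ∀ (j : Fin d) → M (λ _ → ⁅ j ⁆)
    elimination : ∀ A B → M A → M B → ∀ (j : Fin n) →
                  ∃[ C ] (M C × C j ≡ (A j ∪ B j)
                          × (∀ k → C k ≡ A k ⊎ C k ≡ B k ⊎ C k ≡ (A k ∪ B k)))
    comparability : ∀ A B → M A → M B → CGAcyclic A B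
    surrounding : ∀ A C → M A → IsRefinement A C → M C

csuc : ∀ {m} → Fin (suc m) → Fin (suc m)
csuc {m} t = fromℕ< (m%n<n (suc (toℕ t)) (suc m))

-- The bipartite subgraph of K_{n,d} with edges (i,j), j ∈ A_i, has a cycle:
-- distinct left vertices ι_0,…,ι_{m-1} and distinct right vertices
-- κ_0,…,κ_{m-1} (m ≥ 2) with ι_t — κ_t — ι_{t+1 mod m}.
HasCycleK : ∀ {n d} → Tuple n d → Set
HasCycleK {n} {d} A =
  ∃[ m ] Σ (Fin (suc (suc m)) → Fin n) λ ι → Σ (Fin (suc (suc m)) → Fin d) λ κ →
    Injective _≡_ _≡_ ι × Injective _≡_ _≡_ κ
    × (∀ t → κ t ∈ A (ι t) × κ t ∈ A (ι (csuc t)))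

replace : ∀ {n d} → Tuple n d → Fin n → Subset d → Tuple n d
replace A i S i' with i' ≟ i
... | yes _ = S
... | no  _ = A i'

module Submission where

-- Let G be the bipartite graph with rows [n], columns [d] and an edge ι — j
-- whenever j ∈ A ι; by hypothesis G is a forest.  Call two columns
-- neighbours when they lie in a common row ι ≠ i, and let S be the set of
-- columns reachable from k through neighbours, i.e. the columns in the
-- component of k in G with the edge i — k removed.
--
--  * A walk from k to a column j ≠ k of A i that avoids row i can be pruned
--    to one with distinct rows and distinct columns; closing it through row i
--    gives a cycle of G.  Hence k is the only column of A i lying in S.
--  * S is closed under neighbours, so every A ι with ι ≠ i lies entirely
--    inside S or entirely outside S.
--
-- Refining A by the ordered partition (S, [d] ∖ S) therefore keeps every A ι
-- with ι ≠ i and replaces A i by A i ∖ S = A i - k, which is nonempty because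
-- ∣ A i ∣ > 1.  Surrounding then puts this refinement into M.

open import Defs
open import Data.Nat using (ℕ; zero; suc; _<_; _≤_; z≤n; s≤s)
open import Data.Nat.Properties using (≤-trans; ≤-reflexive; <⇒≱; n≮n)
open import Data.Nat.DivMod using (_%_; m<n⇒m%n≡m; n%n≡0)
open import Data.Fin using (Fin; zero; suc; toℕ; fromℕ; inject₁; _≟_)
  renaming (_≤_ to _≤ᶠ_)
open import Data.Fin.Properties using (any?; toℕ-injective; toℕ-fromℕ<; toℕ-fromℕ; toℕ-inject₁; inject₁ℕ<)
  renaming (≤-reflexive to ≤ᶠ-reflexive)
open import Data.Fin.Relation.Unary.Top using (view; ‵fromℕ; ‵inject₁)
open import Data.Fin.Subset using (Subset; _∈_; _∉_; _⊆_; _─_; _-_; ⁅_⁆; ∣_∣; Nonempty; inside)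
open import Data.Fin.Subset.Properties
  using (_∈?_; nonempty?; x∈⁅x⁆; x∈⁅y⁆⇒x≡y; ∣⁅x⁆∣≡1; ∣p∣≤n; p⊆q⇒∣p∣≤∣q∣; p⊂q⇒∣p∣<∣q∣; x∈p∧x≢y⇒x∈p-y; p─q⊆p)
open import Data.Vec using (_∷_; here; there; tabulate)
open import Data.Vec.Properties using (lookup∘tabulate; []=⇒lookup; lookup⇒[]=)
open import Data.Bool using (true; false)
open import Data.List using (List; []; _∷_; _++_; [_]; length; lookup)
open import Data.List.Relation.Unary.All using (All; []; _∷_)
import Data.List.Relation.Unary.All as All
open import Data.List.Relation.Unary.All.Properties using (¬Any⇒All¬; ++⁻ʳ)
open import Data.List.Relation.Unary.AllPairs using (AllPairs; []; _∷_)
import Data.List.Relation.Unary.Any as Any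
open import Data.List.Membership.Propositional using (find)
open import Data.List.Membership.Propositional.Properties using (∈-∃++; ∈-lookup)
open import Data.Product using (Σ; ∃; ∃-syntax; _×_; _,_; proj₁; proj₂)
open import Data.Sum using (_⊎_; inj₁; inj₂)
open import Data.Empty using (⊥-elim)
open import Function using (_on_)
open import Relation.Nullary using (¬_; ¬?; Dec; yes; no; does; contradiction)
open import Relation.Nullary.Decidable using (_×-dec_; _⊎-dec_; dec-true; dec-false; decidable-stable)
open import Relation.Unary using (Decidable)
open import Relation.Binary.PropositionalEquality using (_≡_; _≢_; refl; sym; trans; cong; subst; module ≡-Reasoning)

x∈p─q⇒x∉q : ∀ {d} (p q : Subset d) {x} → x ∈ p ─ q → x ∉ q
x∈p─q⇒x∉q (_ ∷ p) (_ ∷ q)      (there x∈p─q) (there x∈q) = x∈p─q⇒x∉q p q x∈p─q x∈q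
x∈p─q⇒x∉q (_ ∷ p) (inside ∷ q) ()             here

x∈p-y⇒x≢y : ∀ {d} (p : Subset d) {x y} → x ∈ p - y → x ≢ y
x∈p-y⇒x≢y p {x} x∈p-x refl = x∈p─q⇒x∉q p ⁅ x ⁆ x∈p-x (x∈⁅x⁆ x)

p-x-nonempty : ∀ {d} (p : Subset d) x → 1 < ∣ p ∣ → Nonempty (p - x)
p-x-nonempty p x 1<∣p∣ with nonempty? (p - x)
... | yes nonempty = nonempty
... | no empty = contradiction ∣p∣≤1 (<⇒≱ 1<∣p∣)
  where
  p⊆⁅x⁆ : p ⊆ ⁅ x ⁆
  p⊆⁅x⁆ {y} y∈p with y ≟ x
  ... | yes refl = x∈⁅x⁆ x
  ... | no y≢x = ⊥-elim (empty (y , x∈p∧x≢y⇒x∈p-y y∈p y≢x))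
  ∣p∣≤1 : ∣ p ∣ ≤ 1
  ∣p∣≤1 = ≤-trans (p⊆q⇒∣p∣≤∣q∣ p⊆⁅x⁆) (≤-reflexive (∣⁅x⁆∣≡1 x))

subsetOf : ∀ {d} {P : Fin d → Set} → Decidable P → Subset d
subsetOf P? = tabulate (λ j → does (P? j))

∈-subsetOf⁺ : ∀ {d} {P : Fin d → Set} (P? : Decidable P) {j} → P j → j ∈ subsetOf P?
∈-subsetOf⁺ P? {j} pj = lookup⇒[]= j (subsetOf P?) (trans (lookup∘tabulate _ j) (dec-true (P? j) pj))

∈-subsetOf⁻ : ∀ {d} {P : Fin d → Set} (P? : Decidable P) {j} → j ∈ subsetOf P? → P j
∈-subsetOf⁻ P? {j} j∈ = decidable-stable (P? j) λ ¬pj → true≢false (begin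
    true                       ≡⟨ []=⇒lookup j∈ ⟨
    Data.Vec.lookup (subsetOf P?) j ≡⟨ lookup∘tabulate _ j ⟩
    does (P? j)                ≡⟨ dec-false (P? j) ¬pj ⟩
    false                      ∎)
  where
  open ≡-Reasoning
  true≢false : true ≢ false
  true≢false ()

block : ∀ {d} → Subset d → Fin d → Fin 2
block S j with j ∈? S
... | yes _ = zero
... | no  _ = suc zero

block-∈ : ∀ {d} (S : Subset d) {j} → j ∈ S → block S j ≡ zero
block-∈ S {j} j∈S with j ∈? S
... | yes _   = refl
... | no j∉S = contradiction j∈S j∉S

block-∉ : ∀ {d} (S : Subset d) {j} → j ∉ S → block S j ≡ suc zero
block-∉ S {j} j∉S with j ∈? S
... | yes j∈S = contradiction j∈S j∉S
... | no _    = refl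

block≡1⇒∉ : ∀ {d} (S : Subset d) {j} → block S j ≡ suc zero → j ∉ S
block≡1⇒∉ S {j} eq j∈S with j ∈? S
block≡1⇒∉ S {j} () j∈S | yes _
... | no j∉S = j∉S j∈S

block≤1 : ∀ {d} (S : Subset d) j → block S j ≤ᶠ suc (zero {1})
block≤1 S j with j ∈? S
... | yes _ = z≤n
... | no  _ = s≤s z≤n

data RefinesEntry {d} (S : Subset d) (a c : Subset d) : Set where
  kept : ∀ {j₀} → j₀ ∈ a → a ⊆ S → c ≡ a → RefinesEntry S a c
  cut  : ∀ {j₀} → j₀ ∈ a → j₀ ∉ S →
         (∀ {j} → j ∈ c → j ∈ a × j ∉ S) → (∀ {j} → j ∈ a → j ∉ S → j ∈ c) →
         RefinesEntry S a c

twoBlockRefinement : ∀ {n d} (A C : Tuple n d) (S : Subset d) {j₀ j₁ : Fin d} →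
  j₀ ∈ S → j₁ ∉ S → (∀ ι → RefinesEntry S (A ι) (C ι)) → IsRefinement A C
twoBlockRefinement A C S {j₀} {j₁} j₀∈S j₁∉S entries =
  2 , block S , surjective , λ ι → refine (entries ι)
  where
  surjective : IsOrderedPartition (block S)
  surjective zero       = j₀ , λ { refl → block-∈ S j₀∈S }
  surjective (suc zero) = j₁ , λ { refl → block-∉ S j₁∉S }

  refine : ∀ {a c} → RefinesEntry S a c → Σ (Fin 2) λ m →
      (∃[ j ] (j ∈ a × block S j ≡ m))
    × (∀ j → j ∈ a → block S j ≤ᶠ m)
    × (∀ j → (j ∈ c → (j ∈ a × block S j ≡ m)) × ((j ∈ a × block S j ≡ m) → j ∈ c))
  refine (kept j₀∈a a⊆S refl) =
    zero , (_ , j₀∈a , block-∈ S (a⊆S j₀∈a)) , (λ j j∈a → ≤ᶠ-reflexive (block-∈ S (a⊆S j∈a)))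
         , λ j → (λ j∈a → j∈a , block-∈ S (a⊆S j∈a)) , proj₁
  refine (cut j₀∈a j₀∉S c⊆a∖S a∖S⊆c) =
    suc zero , (_ , j₀∈a , block-∉ S j₀∉S) , (λ j _ → block≤1 S j)
             , λ j → (λ j∈c → proj₁ (c⊆a∖S j∈c) , block-∉ S (proj₂ (c⊆a∖S j∈c)))
                   , (λ (j∈a , eq) → a∖S⊆c j∈a (block≡1⇒∉ S eq))

iterate : ∀ {X : Set} → (X → X) → X → ℕ → X
iterate F x zero    = x
iterate F x (suc t) = F (iterate F x t)

iterate-invariant : ∀ {X : Set} (F : X → X) (P : X → Set) {x} →
  P x → (∀ {y} → P y → P (F y)) → ∀ t → P (iterate F x t)
iterate-invariant F P px pF zero    = px
iterate-invariant F P px pF (suc t) = pF (iterate-invariant F P px pF t)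

⊆-or-witness : ∀ {d} (p q : Subset d) → p ⊆ q ⊎ ∃[ x ] (x ∈ p × x ∉ q)
⊆-or-witness p q with any? (λ x → x ∈? p ×-dec ¬? (x ∈? q))
... | yes new = inj₂ new
... | no none = inj₁ λ {x} x∈p → decidable-stable (x ∈? q) λ x∉q → none (x , x∈p , x∉q)

ClosedStage : ∀ {d} (F : Subset d → Subset d) (S₀ : Subset d) → ℕ → Set
ClosedStage F S₀ t = F (iterate F S₀ t) ⊆ iterate F S₀ t

-- For an inflationary F, as long as no closed stage has appeared each step
-- adds a new element, so stage t has at least t elements.
iterate-grows : ∀ {d} (F : Subset d → Subset d) → (∀ {S} → S ⊆ F S) →
  ∀ S₀ t → ∃ (ClosedStage F S₀) ⊎ t ≤ ∣ iterate F S₀ t ∣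
iterate-grows F inflationary S₀ zero = inj₂ z≤n
iterate-grows F inflationary S₀ (suc t) with iterate-grows F inflationary S₀ t
... | inj₁ found = inj₁ found
... | inj₂ t≤∣Sₜ∣ with ⊆-or-witness (F (iterate F S₀ t)) (iterate F S₀ t)
...   | inj₁ closed = inj₁ (t , closed)
...   | inj₂ new    = inj₂ (≤-trans (s≤s t≤∣Sₜ∣) (p⊂q⇒∣p∣<∣q∣ (inflationary , new)))

-- Since a subset of [d] has at most d elements, iterating an inflationary
-- operator reaches a closed stage.
closedIterate : ∀ {d} (F : Subset d → Subset d) → (∀ {S} → S ⊆ F S) →
  ∀ S₀ → ∃ (ClosedStage F S₀)
closedIterate {d} F inflationary S₀ with iterate-grows F inflationary S₀ (suc d)
... | inj₁ found  = found
... | inj₂ d<∣S∣ = contradiction (≤-trans d<∣S∣ (∣p∣≤n (iterate F S₀ (suc d)))) (n≮n d)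

AllPairs-drop : ∀ {X : Set} {R : X → X → Set} as {bs} → AllPairs R (as ++ bs) → AllPairs R bs
AllPairs-drop []       rs       = rs
AllPairs-drop (a ∷ as) (_ ∷ rs) = AllPairs-drop as rs

lookup-injective : ∀ {X Y : Set} {f : X → Y} {xs} → AllPairs (_≢_ on f) xs →
  ∀ {t s} → f (lookup xs t) ≡ f (lookup xs s) → t ≡ s
lookup-injective (_ ∷ _)  {zero}  {zero}  _  = refl
lookup-injective (f≢ ∷ _) {zero}  {suc s} eq = contradiction eq (All.lookup f≢ (∈-lookup s))
lookup-injective (f≢ ∷ _) {suc t} {zero}  eq = contradiction (sym eq) (All.lookup f≢ (∈-lookup t))
lookup-injective (_ ∷ ds) {suc t} {suc s} eq = cong suc (lookup-injective ds eq)

csuc-inject₁ : ∀ {m} (t : Fin m) → csuc (inject₁ t) ≡ suc t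
csuc-inject₁ {m} t = toℕ-injective (begin
  toℕ (csuc (inject₁ t))      ≡⟨ toℕ-fromℕ< _ ⟩
  suc (toℕ (inject₁ t)) % suc m ≡⟨ m<n⇒m%n≡m (s≤s (inject₁ℕ< t)) ⟩
  suc (toℕ (inject₁ t))       ≡⟨ cong suc (toℕ-inject₁ t) ⟩
  suc (toℕ t)                 ∎)
  where open ≡-Reasoning

csuc-fromℕ : ∀ m → csuc (fromℕ m) ≡ zero
csuc-fromℕ m = toℕ-injective (begin
  toℕ (csuc (fromℕ m))        ≡⟨ toℕ-fromℕ< _ ⟩
  suc (toℕ (fromℕ m)) % suc m ≡⟨ cong (λ x → suc x % suc m) (toℕ-fromℕ m) ⟩
  suc m % suc m               ≡⟨ n%n≡0 (suc m) ⟩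
  0                           ∎)
  where open ≡-Reasoning

module AvoidingRow {n d : ℕ} (A : Tuple n d) (i : Fin n) where

  -- A link (ι , κ) passes through row ι to column κ.
  Link : Set
  Link = Fin n × Fin d

  row : Link → Fin n
  row = proj₁

  col : Link → Fin d
  col = proj₂

  Follows : Fin d → Link → Set
  Follows x l = row l ≢ i × x ∈ A (row l) × col l ∈ A (row l)

  -- A walk from column x to column y in G with row i deleted.
  data Chain (x : Fin d) : List Link → Fin d → Set where
    done : Chain x [] x
    step : ∀ {l ls y} → Follows x l → Chain (col l) ls y → Chain x (l ∷ ls) y

  extend : ∀ {x ls y l} → Chain x ls y → Follows y l → Chain x (ls ++ [ l ]) (col l)
  extend done       follows = step follows done
  extend (step f c)   follows = step f (extend c follows)

  dropChain : ∀ {x y} ls {ms} → Chain x (ls ++ ms) y → ∃[ z ] Chain z ms y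
  dropChain []       c          = _ , c
  dropChain (l ∷ ls) (step _ c) = dropChain ls c

  reroute : ∀ {x x' l ls y} → Chain x (l ∷ ls) y → x' ∈ A (row l) → Chain x' (l ∷ ls) y
  reroute (step (row≢i , _ , col∈) c) x'∈ = step (row≢i , x'∈ , col∈) c

  rows-avoid-i : ∀ {x ls y} → Chain x ls y → All (λ l → i ≢ row l) ls
  rows-avoid-i done                  = []
  rows-avoid-i (step (row≢i , _) c) = (λ eq → row≢i (sym eq)) ∷ rows-avoid-i c

  record Simple (x : Fin d) (ls : List Link) : Set where
    constructor simple
    field
      rows-distinct : AllPairs (_≢_ on row) ls
      cols-distinct : AllPairs (_≢_ on col) ls
      cols-avoid    : All (λ l → x ≢ col l) ls
  open Simple

  SimpleChain : Fin d → Fin d → Set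
  SimpleChain x y = ∃[ ls ] (Chain x ls y × Simple x ls)

  restartAt : ∀ {x z y} as {m cs} → Chain z (as ++ m ∷ cs) y → Simple z (as ++ m ∷ cs) →
    x ≡ col m → SimpleChain x y
  restartAt as c s refl
    with dropChain as c | AllPairs-drop as (rows-distinct s) | AllPairs-drop as (cols-distinct s)
  ... | _ , step _ c' | _ ∷ rows | x≢cols ∷ cols = _ , c' , simple rows cols x≢cols

  -- If a simple chain avoiding x revisits a row containing x, jumping from x
  -- straight to that row gives a simple chain from x.
  shortcutAt : ∀ {x z y} as {m cs} → Chain z (as ++ m ∷ cs) y → Simple z (as ++ m ∷ cs) →
    All (λ l → x ≢ col l) (as ++ m ∷ cs) → x ∈ A (row m) → SimpleChain x y
  shortcutAt as c s x≢cols x∈ with dropChain as c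
  ... | _ , c' = _ , reroute c' x∈
               , simple (AllPairs-drop as (rows-distinct s)) (AllPairs-drop as (cols-distinct s))
                        (++⁻ʳ as x≢cols)

  -- Prepending a link l in front of a simple chain from col l, pruning the
  -- repetition this may create: a return to x, or a second visit of row l.
  prepend : ∀ {x l ms y} → Follows x l → Chain (col l) ms y → Simple (col l) ms → SimpleChain x y
  prepend {x} {l} {ms} follows@(_ , x∈row , _) c s with Any.any? (λ m → x ≟ col m) ms
  ... | yes x∈cols with find x∈cols
  ...   | m , m∈ms , x≡col with ∈-∃++ m∈ms
  ...     | as , cs , refl = restartAt as c s x≡col
  prepend {x} {l} {ms} follows@(_ , x∈row , _) c s | no x∉cols with Any.any? (λ m → row l ≟ row m) ms
  ... | yes row∈rows with find row∈rows
  ...   | m , m∈ms , row≡ with ∈-∃++ m∈ms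
  ...     | as , cs , refl =
    shortcutAt as c s (¬Any⇒All¬ _ x∉cols) (subst (λ ι → x ∈ A ι) row≡ x∈row)
  prepend {x} {l} {ms} follows c s | no x∉cols | no row∉rows with x ≟ col l
  ... | yes refl = ms , c , s
  ... | no x≢col = l ∷ ms , step follows c
                 , simple (¬Any⇒All¬ ms row∉rows ∷ rows-distinct s) (cols-avoid s ∷ cols-distinct s)
                          (x≢col ∷ ¬Any⇒All¬ ms x∉cols)

  prune : ∀ {x ls y} → Chain x ls y → SimpleChain x y
  prune done             = [] , done , simple [] [] []
  prune (step follows c) with prune c
  ... | _ , c' , s = prepend follows c' s

  -- Along a chain x = κ₀ → (ι₁ , κ₁) → … with x in row ι₀, each column κₜ but
  -- the last lies in the rows ιₜ and ιₜ₊₁ ...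
  columnInRows : ∀ {ι₀ x ls y} → x ∈ A ι₀ → Chain x ls y → (t : Fin (length ls)) →
    let κₜ = lookup ((ι₀ , x) ∷ ls) (inject₁ t) in
    col κₜ ∈ A (row κₜ) × col κₜ ∈ A (row (lookup ((ι₀ , x) ∷ ls) (suc t)))
  columnInRows x∈ι₀ (step (_ , x∈ι₁ , _) _) zero    = x∈ι₀ , x∈ι₁
  columnInRows _    (step (_ , _ , κ₁∈ι₁) c) (suc t) = columnInRows κ₁∈ι₁ c t

  -- ... while the last column lies in its own row and is the endpoint y.
  lastColumn : ∀ {ι₀ x ls y} → x ∈ A ι₀ → Chain x ls y →
    let κₘ = lookup ((ι₀ , x) ∷ ls) (fromℕ (length ls)) in
    col κₘ ∈ A (row κₘ) × col κₘ ≡ y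
  lastColumn x∈ι₀ done                     = x∈ι₀ , refl
  lastColumn _    (step (_ , _ , κ₁∈ι₁) c) = lastColumn κ₁∈ι₁ c

  closeCycle : ∀ {k y} → k ∈ A i → y ∈ A i → y ≢ k → SimpleChain k y → HasCycleK A
  closeCycle k∈Ai y∈Ai y≢k ([] , done , _) = contradiction refl y≢k
  closeCycle {k} {y} k∈Ai y∈Ai y≢k (l ∷ ls , c , s) =
    length ls , ι , κ
    , lookup-injective (rows-avoid-i c ∷ rows-distinct s)
    , lookup-injective (cols-avoid s ∷ cols-distinct s)
    , adjacent
    where
    cycle : List Link
    cycle = (i , k) ∷ l ∷ ls

    ι : Fin (suc (suc (length ls))) → Fin n
    ι t = row (lookup cycle t)

    κ : Fin (suc (suc (length ls))) → Fin d
    κ t = col (lookup cycle t)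

    adjacent : ∀ t → κ t ∈ A (ι t) × κ t ∈ A (ι (csuc t))
    adjacent t with view t
    ... | ‵fromℕ with lastColumn k∈Ai c
    ...   | κₘ∈ιₘ , refl = κₘ∈ιₘ , subst (λ t → y ∈ A (ι t)) (sym (csuc-fromℕ _)) y∈Ai
    adjacent t | ‵inject₁ t' with columnInRows k∈Ai c t'
    ...   | κₜ∈ιₜ , κₜ∈ιₜ₊₁ = κₜ∈ιₜ , subst (λ s → κ (inject₁ t') ∈ A (ι s)) (sym (csuc-inject₁ t')) κₜ∈ιₜ₊₁

module Component {n d : ℕ} (A : Tuple n d) (i : Fin n) (k : Fin d) where
  open AvoidingRow A i

  Neighbours : Fin d → Fin d → Set
  Neighbours j j' = ∃[ ι ] (ι ≢ i × j ∈ A ι × j' ∈ A ι)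

  neighbours? : ∀ j j' → Dec (Neighbours j j')
  neighbours? j j' = any? λ ι → ¬? (ι ≟ i) ×-dec (j ∈? A ι ×-dec j' ∈? A ι)

  InExpansion : Subset d → Fin d → Set
  InExpansion T j = j ∈ T ⊎ ∃[ j' ] (j' ∈ T × Neighbours j' j)

  inExpansion? : ∀ T → Decidable (InExpansion T)
  inExpansion? T j = j ∈? T ⊎-dec any? (λ j' → j' ∈? T ×-dec neighbours? j' j)

  expand : Subset d → Subset d
  expand T = subsetOf (inExpansion? T)

  expand-inflationary : ∀ {T} → T ⊆ expand T
  expand-inflationary {T} j∈T = ∈-subsetOf⁺ (inExpansion? T) (inj₁ j∈T)

  stabilisation : ∃ (ClosedStage expand ⁅ k ⁆)
  stabilisation = closedIterate expand expand-inflationary ⁅ k ⁆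

  S : Subset d
  S = iterate expand ⁅ k ⁆ (proj₁ stabilisation)

  S-closed : ∀ {j j'} → j ∈ S → Neighbours j j' → j' ∈ S
  S-closed j∈S nb = proj₂ stabilisation (∈-subsetOf⁺ (inExpansion? S) (inj₂ (_ , j∈S , nb)))

  k∈S : k ∈ S
  k∈S = iterate-invariant expand (k ∈_) (x∈⁅x⁆ k) expand-inflationary (proj₁ stabilisation)

  S-reachable : ∀ {j} → j ∈ S → ∃[ ls ] Chain k ls j
  S-reachable = iterate-invariant expand Reachable base expansion (proj₁ stabilisation)
    where
    Reachable : Subset d → Set
    Reachable T = ∀ {j} → j ∈ T → ∃[ ls ] Chain k ls j

    base : Reachable ⁅ k ⁆
    base j∈⁅k⁆ with x∈⁅y⁆⇒x≡y k j∈⁅k⁆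
    ... | refl = [] , done

    expansion : ∀ {T} → Reachable T → Reachable (expand T)
    expansion {T} reach j∈ with ∈-subsetOf⁻ (inExpansion? T) j∈
    ... | inj₁ j∈T = reach j∈T
    ... | inj₂ (j' , j'∈T , ι , ι≢i , j'∈Aι , j∈Aι) with reach j'∈T
    ...   | ls , c = ls ++ [ (ι , _) ] , extend c (ι≢i , j'∈Aι , j∈Aι)

  S∩Ai⊆k : ¬ HasCycleK A → k ∈ A i → ∀ {j} → j ∈ A i → j ∈ S → j ≡ k
  S∩Ai⊆k acyclic k∈Ai {j} j∈Ai j∈S with j ≟ k
  ... | yes j≡k = j≡k
  ... | no j≢k = contradiction (closeCycle k∈Ai j∈Ai j≢k (prune (proj₂ (S-reachable j∈S)))) acyclic

  Ai-k-outside-S : ¬ HasCycleK A → k ∈ A i → ∀ {j} → j ∈ A i - k → j ∉ S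
  Ai-k-outside-S acyclic k∈Ai j∈Ai-k j∈S =
    x∈p-y⇒x≢y (A i) j∈Ai-k (S∩Ai⊆k acyclic k∈Ai (p─q⊆p _ _ j∈Ai-k) j∈S)

  Ai-refines : ¬ HasCycleK A → 1 < ∣ A i ∣ → k ∈ A i → RefinesEntry S (A i) (A i - k)
  Ai-refines acyclic 1<∣Ai∣ k∈Ai with p-x-nonempty (A i) k 1<∣Ai∣
  ... | j₁ , j₁∈Ai-k = cut (p─q⊆p _ _ j₁∈Ai-k) (Ai-k-outside-S acyclic k∈Ai j₁∈Ai-k)
                         (λ j∈ → p─q⊆p _ _ j∈ , Ai-k-outside-S acyclic k∈Ai j∈) inside-Ai-k
    where
    inside-Ai-k : ∀ {j} → j ∈ A i → j ∉ S → j ∈ A i - k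
    inside-Ai-k j∈Ai j∉S = x∈p∧x≢y⇒x∈p-y j∈Ai λ { refl → j∉S k∈S }

  Aι-refines : ∀ {ι} → ι ≢ i → Nonempty (A ι) → RefinesEntry S (A ι) (A ι)
  Aι-refines ι≢i (j₀ , j₀∈Aι) with j₀ ∈? S
  ... | yes j₀∈S = kept j₀∈Aι (λ j∈Aι → S-closed j₀∈S (_ , ι≢i , j₀∈Aι , j∈Aι)) refl
  ... | no j₀∉S  = cut j₀∈Aι j₀∉S (λ j∈Aι → j∈Aι , j∉S j∈Aι) (λ j∈Aι _ → j∈Aι)
    where
    j∉S : ∀ {j} → j ∈ A _ → j ∉ S
    j∉S j∈Aι j∈S = j₀∉S (S-closed j∈S (_ , ι≢i , j∈Aι , j₀∈Aι))

lemma3p8 : ∀ {n d} (M : Tuple n d → Set) → IsTOM n d M →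
           ∀ (A : Tuple n d) → M A → ¬ HasCycleK A →
           ∀ (i : Fin n) → 1 < ∣ A i ∣ → ∀ (k : Fin d) → k ∈ A i →
           M (replace A i (A i - k)) × IsRefinement A (replace A i (A i - k))
lemma3p8 M tom A A∈M acyclic i 1<∣Ai∣ k k∈Ai =
  IsTOM.surrounding tom A _ A∈M refinement , refinement
  where
  open Component A i k

  -- Deciding ι ≟ i also unfolds `replace` at ι.
  entries : ∀ ι → RefinesEntry S (A ι) (replace A i (A i - k) ι)
  entries ι with ι ≟ i
  ... | yes refl = Ai-refines acyclic 1<∣Ai∣ k∈Ai
  ... | no ι≢i  = Aι-refines ι≢i (IsTOM.types tom A A∈M ι)

  refinement : IsRefinement A (replace A i (A i - k))
  refinement = twoBlockRefinement A _ S k∈S j₁∉S entries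
    where
    j₁∉S : proj₁ (p-x-nonempty (A i) k 1<∣Ai∣) ∉ S
    j₁∉S = Ai-k-outside-S acyclic k∈Ai (proj₂ (p-x-nonempty (A i) k 1<∣Ai∣))
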